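{- Let $s,k,i$ be jobs with $i\le k$ and $r_i\ge r_s$. Let $C^*_{s,i}$ be the minimum completion time of job $i$ among all $(s,k)$-schedules (satisfying the earliest-deadline property) that schedule $i$, and let $G_{s,k}$ be the greedy $(s,k)$-schedule. Then $$C^*_{s,i}=C_i(G_{s,k})=\max_{\substack{l\le i\\ r_s\le r_l\le r_i}}\min\{\,b : b>r_i \text{ and } b\ge r_l+\mathrm{load}_i(r_l,b)\,\}.$$ In particular $C^*_{s,i}$ does not depend on $k$.
   Context: Time is discrete, divided into unit slots $[t,t+1)$ (slot $t$), $t\in\mathbb{Z}$. There are $n$ jobs $1,\dots,n$; job $j$ has integer release time $r_j$, deadline $d_j$ and positive integer processing time $p_j$. A (partial, preemptive) schedule $S$ assigns to each slot at most one job, and each job it schedules receives exactly $p_j$ slots, all within $[r_j,d_j)$. $C_j(S)$ is the end of the last slot of $j$, and $C_{\max}(S)=\max_j C_j(S)$. Standing assumptions: $d_1<d_2<\dots<d_n$, all release times are pairwise distinct, and the instance is feasible (some schedule schedules all jobs). All schedules are assumed to have the earliest-deadline property: at every slot $t$, $S$ is either idle or executes, among the jobs scheduled by $S$ that are released at or before $t$ and not yet completed, the one with smallest deadline. For jobs $s$ and $k$, an $(s,k)$-schedule is a partial schedule $S$ with $C_{\max}(S)\le d_k$ whose set of scheduled jobs is exactly $\{j\le k: r_s\le r_j<C_{\max}(S)\}$; the empty schedule is also an $(s,k)$-schedule, with completion time $r_s$. The greedy schedule $G_{s,k}$ is obtained by considering the jobs $j\le k$ with $r_j\ge r_s$ and,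 for each slot $t=r_s,r_s+1,\dots$, executing the pending such job (released, not completed) with earliest deadline, idling if none is pending. For times $a<b$ and a job $i$, $\mathrm{load}_i(a,b)=\sum_{j\le i,\ a\le r_j<b}p_j$. -}

module Defs where

open import Data.Nat as ℕ using (ℕ; zero; suc; _∸_)
open import Data.Integer as ℤ using (ℤ; +_; -[1+_]; _-_; _≤ᵇ_; _<_; _≤_; _⊔_; ∣_∣; 0ℤ; 1ℤ)
open import Data.Fin as Fin using (Fin; toℕ)
open import Data.Fin.Properties using () renaming (_≟_ to _≟ᶠ_)
open import Data.Bool using (Bool; true; false; if_then_else_; _∧_; not)
open import Data.Maybe using (Maybe; just; nothing)
import Data.Maybe as Maybe
open import Data.List using (map; allFin)
open import Data.Nat.ListAction using (sum)
open import Data.Product using (_×_; ∃; Σ)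
open import Data.Sum using (_⊎_)
open import Function using (_∘_; _⇔_)
open import Relation.Nullary using (¬_; does)
open import Relation.Binary.PropositionalEquality using (_≡_; _≢_)

-- Jobs are Fin n (job j of the paper is the (j-1)-th element of Fin n);
-- the order on jobs is the order on Fin n.  Time slots are integers;
-- slot t is [t, t+1).  An instance is given by release times r,
-- deadlines d (integers) and processing times p (naturals).

Schedule : ℕ → Set
Schedule n = ℤ → Maybe (Fin n)

isJob : ∀ {n} → Maybe (Fin n) → Fin n → Bool
isJob nothing  j = false
isJob (just x) j = does (x ≟ᶠ j)

countFrom : (ℤ → Bool) → ℤ → ℕ → ℕ
countFrom f a zero    = 0
countFrom f a (suc m) = (if f a then 1 else 0) ℕ.+ countFrom f (a ℤ.+ 1ℤ) m

module _ {n : ℕ} (r d : Fin n → ℤ) (p : Fin n → ℕ) where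

  slots : Schedule n → Fin n → ℕ
  slots S j = countFrom (λ t → isJob (S t) j) (r j) ∣ (d j - r j) ⊔ 0ℤ ∣

  Scheduled : Schedule n → Fin n → Set
  Scheduled S j = slots S j ≡ p j

  ValidSchedule : Schedule n → Set
  ValidSchedule S =
    (∀ t j → S t ≡ just j → (r j ≤ t × t < d j)) ×
    (∀ j → slots S j ≡ 0 ⊎ slots S j ≡ p j)

  -- earliest-deadline property: if S executes j at slot t then j has the
  -- smallest deadline among the jobs scheduled by S that are released at
  -- or before t and not yet completed (still have a slot at or after t).
  EarliestDeadline : Schedule n → Set
  EarliestDeadline S =
    ∀ t j j' → S t ≡ just j → Scheduled S j' → r j' ≤ t →
    (∃ λ t' → t ≤ t' × S t' ≡ just j') → d j ≤ d j'

  Feasible : Set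
  Feasible = ∃ λ S → ValidSchedule S × EarliestDeadline S × (∀ j → Scheduled S j)

-- C_j(S) = c : the last slot of j is slot c - 1
IsCompletion : ∀ {n} → Schedule n → Fin n → ℤ → Set
IsCompletion S j c = S (c - 1ℤ) ≡ just j × (∀ t → c ≤ t → S t ≢ just j)

module _ {n : ℕ} (r d : Fin n → ℤ) (p : Fin n → ℕ) where

  -- C_max(S) = c, where the empty schedule has completion time r s
  IsCmax : Fin n → Schedule n → ℤ → Set
  IsCmax s S c =
    ((∀ t → S t ≡ nothing) × c ≡ r s) ⊎
    (S (c - 1ℤ) ≢ nothing × (∀ t → c ≤ t → S t ≡ nothing))

  SKSchedule : Fin n → Fin n → Schedule n → Set
  SKSchedule s k S =
    ValidSchedule r d p S × EarliestDeadline r d p S ×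
    ∃ λ c → IsCmax s S c × c ≤ d k ×
      (∀ j → Scheduled r d p S j ⇔ (j Fin.≤ k × r s ≤ r j × r j < c))

  IsMinCompletion : Fin n → Fin n → Fin n → ℤ → Set
  IsMinCompletion s k i c =
    (∃ λ S → SKSchedule s k S × Scheduled r d p S i × IsCompletion S i c) ×
    (∀ S c' → SKSchedule s k S → Scheduled r d p S i → IsCompletion S i c' → c ≤ c')

firstTrue : ∀ {n} → (Fin n → Bool) → Maybe (Fin n)
firstTrue {zero}  f = nothing
firstTrue {suc n} f = if f Fin.zero then just Fin.zero else Maybe.map Fin.suc (firstTrue (f ∘ Fin.suc))

module Greedy {n : ℕ} (r : Fin n → ℤ) (p : Fin n → ℕ) (s k : Fin n) where

  eligible : Fin n → Bool
  eligible j = (toℕ j ℕ.≤ᵇ toℕ k) ∧ (r s ≤ᵇ r j)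

  mutual
    -- remaining processing of each job just before slot r s + m
    rem : ℕ → Fin n → ℕ
    rem zero    j = if eligible j then p j else 0
    rem (suc m) j = if isJob (choice m) j then rem m j ∸ 1 else rem m j

    -- job executed at slot r s + m: the pending (released, not completed)
    -- job with the smallest index, i.e. the earliest deadline
    choice : ℕ → Maybe (Fin n)
    choice m = firstTrue (λ j → (r j ≤ᵇ (r s ℤ.+ + m)) ∧ not (rem m j ℕ.≡ᵇ 0))

  greedyAt : ℤ → Maybe (Fin n)
  greedyAt (+ m)    = choice m
  greedyAt -[1+ m ] = nothing

  greedy : Schedule n
  greedy t = greedyAt (t - r s)

module _ {n : ℕ} (r : Fin n → ℤ) (p : Fin n → ℕ) where

  load : Fin n → ℤ → ℤ → ℕ
  load i a b = sum (map (λ j → if (toℕ j ℕ.≤ᵇ toℕ i) ∧ (a ≤ᵇ r j) ∧ not (b ≤ᵇ r j) then p j else 0) (allFin n))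

  Bset : Fin n → Fin n → ℤ → Set
  Bset i l b = r i < b × r l ℤ.+ + load i (r l) b ≤ b

  IsLeastB : Fin n → Fin n → ℤ → Set
  IsLeastB i l b = Bset i l b × (∀ b' → Bset i l b' → b ≤ b')

  InRange : Fin n → Fin n → Fin n → Set
  InRange s i l = l Fin.≤ i × r s ≤ r l × r l ≤ r i

  IsMaxMin : Fin n → Fin n → ℤ → Set
  IsMaxMin s i v =
    (∃ λ l → InRange s i l × IsLeastB i l v) ×
    (∀ l b → InRange s i l → IsLeastB i l b → b ≤ v)

-- Lower bound: in an (s,k)-schedule that completes i at c, every job j ≤ i released in [r_l, c)
-- is i or has a smaller deadline than i, and it is released while i is unfinished; by the
-- earliest-deadline property it therefore finishes before c. These jobs fit into [r_l, c), so
-- c ≥ r_l + load_i(r_l, c) for every l in range.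
-- Attainment: let the greedy complete i at C and let a be the onset of the maximal run of steps
-- before C that execute only jobs ≤ i. No job ≤ i released before a is still pending at a, and
-- a = r_l for the job l run at a. From a on the greedy works without pause on the load released
-- since a, so every b < C with b > r_i satisfies b < r_l + load_i(r_l, b) because i is unfinished
-- at b. Hence C is the least admissible b for this l and, by the lower bound, the maximum over l.
-- Feasibility of the instance makes the greedy meet every deadline (an overdue job would overload
-- the window before its deadline), so the greedy is itself an (s,k)-schedule.
module Submission where

open import Defs
open import Data.Nat using (ℕ)
open import Data.Integer using (ℤ; _≤_)
open import Data.Fin using (Fin; _<_)
open import Data.Product using (_×_; ∃)
open import Function.Definitions using (Injective)
open import Relation.Binary.PropositionalEquality using (_≡_)
import Data.Nat as ℕ
import Data.Integer as ℤ

import Data.Nat.Properties as NP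
import Data.Integer.Properties as ZP
import Data.Fin as F
import Data.Fin.Properties as FP
import Data.Integer.Tactic.RingSolver as ZR
import Data.Nat.Tactic.RingSolver as NR
open import Algebra.Properties.CommutativeMonoid.Sum NP.+-0-commutativeMonoid
  using (sum-cong-≗; ∑-distrib-+; sum-remove; sum-replicate-zero) renaming (sum to ∑)
open import Data.Bool using (Bool; true; false; if_then_else_; _∧_; not; T)
open import Data.Bool.Properties using (∧-zeroʳ; T-≡)
open import Data.Maybe using (Maybe; just; nothing)
open import Data.Maybe.Properties using (just-injective; ≡-dec)
open import Data.List using (tabulate)
open import Data.List.Properties using (map-tabulate)
open import Data.Nat.ListAction using (sum)
open import Data.Product using (_,_; proj₁; proj₂)
open import Data.Sum using (_⊎_; inj₁; inj₂)
open import Relation.Nullary using (¬_; Dec; yes; no; contradiction)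
open import Relation.Binary.Definitions using (tri<; tri≈; tri>)
open import Relation.Binary.PropositionalEquality using (refl; sym; trans; cong; cong₂; subst; subst₂; _≢_; module ≡-Reasoning)
open import Function using (_⇔_; mk⇔; _∘_)
import Function

∑-mono-≤ : ∀ {n} {f g : Fin n → ℕ} → (∀ j → f j ℕ.≤ g j) → ∑ f ℕ.≤ ∑ g
∑-mono-≤ {ℕ.zero}  f≤g = ℕ.z≤n
∑-mono-≤ {ℕ.suc n} f≤g = NP.+-mono-≤ (f≤g F.zero) (∑-mono-≤ (f≤g ∘ F.suc))

f≤∑f : ∀ {n} (f : Fin n → ℕ) x → f x ℕ.≤ ∑ f
f≤∑f {ℕ.suc n} f x = NP.≤-trans (NP.m≤m+n (f x) _) (NP.≤-reflexive (sym (sum-remove {i = x} f)))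

∑-zero : ∀ {n} {f : Fin n → ℕ} → (∀ j → f j ≡ 0) → ∑ f ≡ 0
∑-zero {n} f≡0 = trans (sum-cong-≗ f≡0) (sum-replicate-zero n)

∑-single : ∀ {n} (f : Fin n → ℕ) x → (∀ j → j ≢ x → f j ≡ 0) → ∑ f ≡ f x
∑-single {ℕ.suc n} f x f≡0 = begin
  ∑ f                        ≡⟨ sum-remove {i = x} f ⟩
  f x ℕ.+ ∑ (f ∘ F.punchIn x) ≡⟨ cong (f x ℕ.+_) (∑-zero (λ j → f≡0 _ (FP.punchInᵢ≢i x j))) ⟩
  f x ℕ.+ 0                   ≡⟨ NP.+-identityʳ (f x) ⟩
  f x                         ∎
  where open ≡-Reasoning

sum-tabulate : ∀ {n} (f : Fin n → ℕ) → sum (tabulate f) ≡ ∑ f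
sum-tabulate {ℕ.zero}  f = refl
sum-tabulate {ℕ.suc n} f = cong (f F.zero ℕ.+_) (sum-tabulate (f ∘ F.suc))

infixl 6 _⊕_

_⊕_ : ℤ → ℕ → ℤ
a ⊕ m = a ℤ.+ ℤ.+ m

⊕-identityʳ : ∀ a → a ⊕ 0 ≡ a
⊕-identityʳ = ZP.+-identityʳ

⊕-assoc : ∀ a e f → a ⊕ e ⊕ f ≡ a ⊕ (e ℕ.+ f)
⊕-assoc a e f = ZP.+-assoc a (ℤ.+ e) (ℤ.+ f)

⊕-suc : ∀ a e → a ⊕ e ℤ.+ ℤ.1ℤ ≡ a ⊕ ℕ.suc e
⊕-suc a e = lemma a (ℤ.+ e)
  where lemma : ∀ a x → (a ℤ.+ x) ℤ.+ ℤ.1ℤ ≡ a ℤ.+ (ℤ.1ℤ ℤ.+ x)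
        lemma = ZR.solve-∀

⊕-suc-pred : ∀ a m → a ⊕ ℕ.suc m ℤ.- ℤ.1ℤ ≡ a ⊕ m
⊕-suc-pred a m = lemma a (ℤ.+ m)
  where lemma : ∀ a x → (a ℤ.+ (ℤ.1ℤ ℤ.+ x)) ℤ.- ℤ.1ℤ ≡ a ℤ.+ x
        lemma = ZR.solve-∀

⊕-suc-sucℤ : ∀ a m → a ⊕ ℕ.suc m ≡ ℤ.suc (a ⊕ m)
⊕-suc-sucℤ a m = lemma a (ℤ.+ m)
  where lemma : ∀ a x → a ℤ.+ (ℤ.1ℤ ℤ.+ x) ≡ ℤ.1ℤ ℤ.+ (a ℤ.+ x)
        lemma = ZR.solve-∀

i≤i⊕m : ∀ a m → a ≤ a ⊕ m
i≤i⊕m a m = ZP.i≤i+j a (ℤ.+ m)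

⊕-monoʳ-≤ : ∀ a {e f} → e ℕ.≤ f → a ⊕ e ≤ a ⊕ f
⊕-monoʳ-≤ a e≤f = ZP.+-monoʳ-≤ a (ℤ.+≤+ e≤f)

⊕-monoʳ-< : ∀ a {e f} → e ℕ.< f → a ⊕ e ℤ.< a ⊕ f
⊕-monoʳ-< a e<f = ZP.+-monoʳ-< a (ℤ.+<+ e<f)

i<i⊕suc : ∀ a m → a ℤ.< a ⊕ ℕ.suc m
i<i⊕suc a m = subst (ℤ._< a ⊕ ℕ.suc m) (⊕-identityʳ a) (⊕-monoʳ-< a (ℕ.s≤s ℕ.z≤n))

⊕-cancelˡ-≤ : ∀ a {e f} → a ⊕ e ≤ a ⊕ f → e ℕ.≤ f
⊕-cancelˡ-≤ a {e} {f} le = ZP.drop‿+≤+ (subst₂ _≤_ (lemma a (ℤ.+ e)) (lemma a (ℤ.+ f)) (ZP.+-monoʳ-≤ (ℤ.- a) le))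
  where lemma : ∀ a x → ℤ.- a ℤ.+ (a ℤ.+ x) ≡ x
        lemma = ZR.solve-∀

⊕-cancelˡ-< : ∀ a {e f} → a ⊕ e ℤ.< a ⊕ f → e ℕ.< f
⊕-cancelˡ-< a {e} lt =
  ⊕-cancelˡ-≤ a (subst (_≤ _) (trans (ZP.+-comm ℤ.1ℤ (a ⊕ e)) (⊕-suc a e)) (ZP.i<j⇒suc[i]≤j lt))

i≤j⇒∃[o]j≡i⊕o : ∀ {a b} → a ≤ b → ∃ λ o → b ≡ a ⊕ o
i≤j⇒∃[o]j≡i⊕o {a} {b} a≤b =
  ℤ.∣ b ℤ.- a ∣ , sym (trans (cong (λ x → a ℤ.+ x) (ZP.0≤i⇒+∣i∣≡i (ZP.i≤j⇒0≤j-i a≤b))) (lemma a b))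
  where lemma : ∀ a b → a ℤ.+ (b ℤ.- a) ≡ b
        lemma = ZR.solve-∀

i<j⇒i≤j-1 : ∀ {x c} → x ℤ.< c → x ≤ c ℤ.- ℤ.1ℤ
i<j⇒i≤j-1 {x} {c} lt = subst (x ≤_) (ZP.+-comm ℤ.-1ℤ c) (ZP.i<j⇒i≤pred[j] lt)

i≤j-1⇒i<j : ∀ {x c} → x ≤ c ℤ.- ℤ.1ℤ → x ℤ.< c
i≤j-1⇒i<j {x} {c} le = ZP.i≤pred[j]⇒i<j (subst (x ≤_) (ZP.+-comm c ℤ.-1ℤ) le)

[_] : Bool → ℕ
[ b ] = if b then 1 else 0

[b]≤1 : ∀ b → [ b ] ℕ.≤ 1
[b]≤1 true  = ℕ.s≤s ℕ.z≤n
[b]≤1 false = ℕ.z≤n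

countFrom-none : ∀ (f : ℤ → Bool) a m → (∀ t → a ≤ t → t ℤ.< a ⊕ m → f t ≡ false) → countFrom f a m ≡ 0
countFrom-none f a ℕ.zero    none = refl
countFrom-none f a (ℕ.suc m) none with f a in fa
... | true  = contradiction (trans (sym fa) (none a ZP.≤-refl (i<i⊕suc a m))) λ ()
... | false = countFrom-none f (a ℤ.+ ℤ.1ℤ) m λ t a+1≤t t<end →
  none t (ZP.≤-trans (i≤i⊕m a 1) a+1≤t) (subst (t ℤ.<_) (ZP.+-assoc a ℤ.1ℤ (ℤ.+ m)) t<end)

countFrom-+ : ∀ (f : ℤ → Bool) a m m' → countFrom f a (m ℕ.+ m') ≡ countFrom f a m ℕ.+ countFrom f (a ⊕ m) m'
countFrom-+ f a ℕ.zero    m' = cong (λ b → countFrom f b m') (sym (⊕-identityʳ a))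
countFrom-+ f a (ℕ.suc m) m' = begin
  [ f a ] ℕ.+ countFrom f (a ℤ.+ ℤ.1ℤ) (m ℕ.+ m')
    ≡⟨ cong ([ f a ] ℕ.+_) (countFrom-+ f (a ℤ.+ ℤ.1ℤ) m m') ⟩
  [ f a ] ℕ.+ (countFrom f (a ℤ.+ ℤ.1ℤ) m ℕ.+ countFrom f (a ℤ.+ ℤ.1ℤ ⊕ m) m')
    ≡⟨ sym (NP.+-assoc [ f a ] _ _) ⟩
  [ f a ] ℕ.+ countFrom f (a ℤ.+ ℤ.1ℤ) m ℕ.+ countFrom f (a ℤ.+ ℤ.1ℤ ⊕ m) m'
    ≡⟨ cong (λ b → countFrom f a (ℕ.suc m) ℕ.+ countFrom f b m') (ZP.+-assoc a ℤ.1ℤ (ℤ.+ m)) ⟩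
  countFrom f a (ℕ.suc m) ℕ.+ countFrom f (a ⊕ ℕ.suc m) m' ∎
  where open ≡-Reasoning

countFrom-≤-support : ∀ (f : ℤ → Bool) a m m' → (∀ t → f t ≡ true → t ℤ.< a ⊕ m') →
                      countFrom f a m ℕ.≤ countFrom f a m'
countFrom-≤-support f a m m' support with NP.≤-total m m'
... | inj₁ m≤m' = begin
  countFrom f a m                                           ≤⟨ NP.m≤m+n _ _ ⟩
  countFrom f a m ℕ.+ countFrom f (a ⊕ m) (m' ℕ.∸ m)         ≡⟨ countFrom-+ f a m (m' ℕ.∸ m) ⟨
  countFrom f a (m ℕ.+ (m' ℕ.∸ m))                          ≡⟨ cong (countFrom f a) (NP.m+[n∸m]≡n m≤m') ⟩
  countFrom f a m'                                          ∎
  where open NP.≤-Reasoning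
... | inj₂ m'≤m = NP.≤-reflexive (begin
  countFrom f a m                                           ≡⟨ cong (countFrom f a) (NP.m+[n∸m]≡n m'≤m) ⟨
  countFrom f a (m' ℕ.+ (m ℕ.∸ m'))                         ≡⟨ countFrom-+ f a m' (m ℕ.∸ m') ⟩
  countFrom f a m' ℕ.+ countFrom f (a ⊕ m') (m ℕ.∸ m')       ≡⟨ cong (countFrom f a m' ℕ.+_) (countFrom-none f _ _ none) ⟩
  countFrom f a m' ℕ.+ 0                                    ≡⟨ NP.+-identityʳ _ ⟩
  countFrom f a m'                                          ∎)
  where
  open ≡-Reasoning
  none : ∀ t → a ⊕ m' ≤ t → t ℤ.< a ⊕ m' ⊕ (m ℕ.∸ m') → f t ≡ false
  none t a⊕m'≤t _ with f t in ft
  ... | true  = contradiction (support t ft) (ZP.≤⇒≯ a⊕m'≤t)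
  ... | false = refl

countFrom-≤-window : ∀ (f : ℤ → Bool) a m a' m' → (∀ t → f t ≡ true → a ≤ t × t ℤ.< a ⊕ m) →
                     a ≤ a' → countFrom f a' m' ℕ.≤ countFrom f a m
countFrom-≤-window f a m a' m' support a≤a' with i≤j⇒∃[o]j≡i⊕o a≤a'
... | e , refl with NP.≤-total e m
...   | inj₁ e≤m = begin
  countFrom f (a ⊕ e) m'                         ≤⟨ countFrom-≤-support f (a ⊕ e) m' (m ℕ.∸ e) support′ ⟩
  countFrom f (a ⊕ e) (m ℕ.∸ e)                  ≤⟨ NP.m≤n+m _ _ ⟩
  countFrom f a e ℕ.+ countFrom f (a ⊕ e) (m ℕ.∸ e) ≡⟨ countFrom-+ f a e (m ℕ.∸ e) ⟨
  countFrom f a (e ℕ.+ (m ℕ.∸ e))                 ≡⟨ cong (countFrom f a) (NP.m+[n∸m]≡n e≤m) ⟩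
  countFrom f a m                                 ∎
  where
  open NP.≤-Reasoning
  support′ : ∀ t → f t ≡ true → t ℤ.< a ⊕ e ⊕ (m ℕ.∸ e)
  support′ t ft = subst (t ℤ.<_) (trans (cong (a ⊕_) (sym (NP.m+[n∸m]≡n e≤m))) (sym (⊕-assoc a e (m ℕ.∸ e))))
                        (proj₂ (support t ft))
...   | inj₂ m≤e = NP.≤-trans (NP.≤-reflexive (countFrom-none f (a ⊕ e) m' none)) ℕ.z≤n
  where
  none : ∀ t → a ⊕ e ≤ t → t ℤ.< a ⊕ e ⊕ m' → f t ≡ false
  none t a⊕e≤t _ with f t in ft
  ... | true  = contradiction (ZP.≤-trans (⊕-monoʳ-≤ a m≤e) a⊕e≤t) (ZP.<⇒≱ (proj₂ (support t ft)))
  ... | false = refl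

∑-countFrom-≤ : ∀ {n} (g : Fin n → ℤ → Bool) a m → (∀ t → ∑ (λ j → [ g j t ]) ℕ.≤ 1) →
                ∑ (λ j → countFrom (g j) a m) ℕ.≤ m
∑-countFrom-≤ {n} g a ℕ.zero atMostOne = NP.≤-reflexive (∑-zero {n} (λ _ → refl))
∑-countFrom-≤ g a (ℕ.suc m) atMostOne =
  subst (ℕ._≤ ℕ.suc m) (sym (∑-distrib-+ (λ j → [ g j a ]) (λ j → countFrom (g j) (a ℤ.+ ℤ.1ℤ) m)))
        (NP.+-mono-≤ (atMostOne a) (∑-countFrom-≤ g (a ℤ.+ ℤ.1ℤ) m atMostOne))

isJob⇒≡just : ∀ {n} (m : Maybe (Fin n)) j → isJob m j ≡ true → m ≡ just j
isJob⇒≡just (just x) j eq with x FP.≟ j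
... | yes refl = refl
isJob⇒≡just (just x) j () | no _

isJob-refl : ∀ {n} (j : Fin n) → isJob (just j) j ≡ true
isJob-refl j with j FP.≟ j
... | yes _  = refl
... | no j≢j = contradiction refl j≢j

≢just⇒¬isJob : ∀ {n} (m : Maybe (Fin n)) j → m ≢ just j → isJob m j ≡ false
≢just⇒¬isJob nothing  j _ = refl
≢just⇒¬isJob (just x) j m≢j with x FP.≟ j
... | yes refl = contradiction refl m≢j
... | no _     = refl

isJob-≢ : ∀ {n} (x j : Fin n) → j ≢ x → isJob (just x) j ≡ false
isJob-≢ x j j≢x = ≢just⇒¬isJob (just x) j (j≢x ∘ sym ∘ just-injective)

∑[isJob]≡1 : ∀ {n} (x : Fin n) → ∑ (λ j → [ isJob (just x) j ]) ≡ 1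
∑[isJob]≡1 x = trans (∑-single _ x (λ j j≢x → cong [_] (isJob-≢ x j j≢x))) (cong [_] (isJob-refl x))

∑[isJob]≤1 : ∀ {n} (Q : Fin n → Bool) m → ∑ (λ j → [ Q j ∧ isJob m j ]) ℕ.≤ 1
∑[isJob]≤1 Q nothing  = NP.≤-trans (NP.≤-reflexive (∑-zero (λ j → cong [_] (∧-zeroʳ (Q j))))) ℕ.z≤n
∑[isJob]≤1 Q (just x) =
  subst (ℕ._≤ 1) (sym (∑-single _ x λ j j≢x →
    trans (cong (λ b → [ Q j ∧ b ]) (isJob-≢ x j j≢x)) (cong [_] (∧-zeroʳ (Q j)))))
        ([b]≤1 _)

module _ {n : ℕ} (r d : Fin n → ℤ) (p : Fin n → ℕ) where

  -- Each slot of [a, a + m) hosts at most one job.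
  scheduled-∑-≤ : ∀ (S : Schedule n) (Q : Fin n → Bool) a m →
    (∀ t j → S t ≡ just j → r j ≤ t) →
    (∀ j → Q j ≡ true → Scheduled r d p S j × a ≤ r j) →
    (∀ t j → Q j ≡ true → S t ≡ just j → t ℤ.< a ⊕ m) →
    ∑ (λ j → if Q j then p j else 0) ℕ.≤ m
  scheduled-∑-≤ S Q a m released inQ before =
    NP.≤-trans (∑-mono-≤ p≤count) (∑-countFrom-≤ (λ j t → Q j ∧ isJob (S t) j) a m (∑[isJob]≤1 Q ∘ S))
    where
    p≤count : ∀ j → (if Q j then p j else 0) ℕ.≤ countFrom (λ t → Q j ∧ isJob (S t) j) a m
    p≤count j with Q j in qj
    ... | false = ℕ.z≤n
    ... | true  = subst (ℕ._≤ _) (proj₁ (inQ j qj))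
      (countFrom-≤-window (λ t → isJob (S t) j) a m (r j) ℤ.∣ (d j ℤ.- r j) ℤ.⊔ ℤ.0ℤ ∣ support (proj₂ (inQ j qj)))
      where
      support : ∀ t → isJob (S t) j ≡ true → a ≤ t × t ℤ.< a ⊕ m
      support t run = ZP.≤-trans (proj₂ (inQ j qj)) (released t j (isJob⇒≡just (S t) j run)) ,
                      before t j qj (isJob⇒≡just (S t) j run)

≡true⇒T : ∀ {b} → b ≡ true → T b
≡true⇒T = Function.Equivalence.from T-≡

T⇒≡true : ∀ {b} → T b → b ≡ true
T⇒≡true = Function.Equivalence.to T-≡

ℕ≤ᵇ⇒≤ : ∀ {m m'} → (m ℕ.≤ᵇ m') ≡ true → m ℕ.≤ m'
ℕ≤ᵇ⇒≤ {m} {m'} eq = NP.≤ᵇ⇒≤ m m' (≡true⇒T eq)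

ℕ≤⇒≤ᵇ : ∀ {m m'} → m ℕ.≤ m' → (m ℕ.≤ᵇ m') ≡ true
ℕ≤⇒≤ᵇ le = T⇒≡true (NP.≤⇒≤ᵇ le)

≤ᵇ⇒≤ : ∀ {x y} → (x ℤ.≤ᵇ y) ≡ true → x ≤ y
≤ᵇ⇒≤ eq = ZP.≤ᵇ⇒≤ (≡true⇒T eq)

≤⇒≤ᵇ : ∀ {x y} → x ≤ y → (x ℤ.≤ᵇ y) ≡ true
≤⇒≤ᵇ le = T⇒≡true (ZP.≤⇒≤ᵇ le)

≰ᵇ⇒> : ∀ {x y} → (x ℤ.≤ᵇ y) ≡ false → y ℤ.< x
≰ᵇ⇒> eq = ZP.≰⇒> (λ le → contradiction (trans (sym (≤⇒≤ᵇ le)) eq) λ ())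

>⇒≰ᵇ : ∀ {x y} → y ℤ.< x → (x ℤ.≤ᵇ y) ≡ false
>⇒≰ᵇ {x} {y} lt with x ℤ.≤ᵇ y in eq
... | true  = contradiction (≤ᵇ⇒≤ eq) (ZP.<⇒≱ lt)
... | false = refl

inLoad : ∀ {n} → (Fin n → ℤ) → Fin n → ℤ → ℤ → Fin n → Bool
inLoad r i a b j = (F.toℕ j ℕ.≤ᵇ F.toℕ i) ∧ (a ℤ.≤ᵇ r j) ∧ not (b ℤ.≤ᵇ r j)

load≡∑ : ∀ {n} (r : Fin n → ℤ) (p : Fin n → ℕ) i a b →
         load r p i a b ≡ ∑ (λ j → if inLoad r i a b j then p j else 0)
load≡∑ {n} r p i a b = trans (cong sum (map-tabulate {n = n} Function.id _)) (sum-tabulate {n} _)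

inLoad⇒ : ∀ {n} (r : Fin n → ℤ) i a b j → inLoad r i a b j ≡ true → j F.≤ i × a ≤ r j × r j ℤ.< b
inLoad⇒ r i a b j eq with F.toℕ j ℕ.≤ᵇ F.toℕ i in e₁ | a ℤ.≤ᵇ r j in e₂ | b ℤ.≤ᵇ r j in e₃
... | true | true | false = ℕ≤ᵇ⇒≤ e₁ , ≤ᵇ⇒≤ e₂ , ≰ᵇ⇒> e₃

inLoad⇐ : ∀ {n} (r : Fin n → ℤ) i a b j → j F.≤ i → a ≤ r j → r j ℤ.< b → inLoad r i a b j ≡ true
inLoad⇐ r i a b j j≤i a≤rj rj<b rewrite ℕ≤⇒≤ᵇ j≤i | ≤⇒≤ᵇ a≤rj | >⇒≰ᵇ rj<b = refl

-- Completion times of arbitrary (s,k)-schedules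

running⇒<completion : ∀ {n} {S : Schedule n} {i c t} → IsCompletion S i c → S t ≡ just i → t ℤ.< c
running⇒<completion {c = c} {t} (_ , idleAfter) Sti with t ZP.<? c
... | yes t<c = t<c
... | no  t≮c = contradiction Sti (idleAfter t (ZP.≮⇒≥ t≮c))

module _ {n : ℕ} (r d : Fin n → ℤ) (p : Fin n → ℕ) where

  running⇒<Cmax : ∀ {s S C t j} → IsCmax r d p s S C → S t ≡ just j → t ℤ.< C
  running⇒<Cmax (inj₁ (idle , _)) Stj = contradiction (trans (sym Stj) (idle _)) λ ()
  running⇒<Cmax {C = C} {t} (inj₂ (_ , idleAfter)) Stj with C ZP.≤? t
  ... | yes C≤t = contradiction (trans (sym Stj) (idleAfter t C≤t)) λ ()
  ... | no  C≰t = ZP.≰⇒> C≰t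

  edf-finishes-before : ∀ {S i c j t} → EarliestDeadline r d p S → IsCompletion S i c →
    Scheduled r d p S j → d j ℤ.< d i → r j ℤ.< c → S t ≡ just j → t ℤ.< c
  edf-finishes-before {c = c} {t = t} edf (Sc-1≡i , _) schj dj<di rj<c Stj with t ZP.<? c
  ... | yes t<c = t<c
  ... | no  t≮c = contradiction (edf (c ℤ.- ℤ.1ℤ) _ _ Sc-1≡i schj (i<j⇒i≤j-1 rj<c) (t , c-1≤t , Stj)) (ZP.<⇒≱ dj<di)
    where c-1≤t = ZP.≤-trans (ZP.<⇒≤ (i≤j-1⇒i<j ZP.≤-refl)) (ZP.≮⇒≥ t≮c)

  completion∈Bset : (∀ j j' → j < j' → d j ℤ.< d j') →
    ∀ {s k i l S c} → i F.≤ k → SKSchedule r d p s k S → IsCompletion S i c → InRange r p s i l → Bset r p i l c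
  completion∈Bset d-mono {s} {k} {i} {l} {S} {c} i≤k (valid , edf , C , isCmax , _ , scheduled⇔) (Sc-1≡i , idleAfter)
                  (l≤i , rs≤rl , rl≤ri) = ri<c , subst (r l ⊕ load r p i (r l) c ≤_) (sym c≡) (⊕-monoʳ-≤ (r l) load≤L)
    where
    ri<c : r i ℤ.< c
    ri<c = i≤j-1⇒i<j (proj₁ (proj₁ valid _ i Sc-1≡i))
    offset = i≤j⇒∃[o]j≡i⊕o (ZP.≤-trans rl≤ri (ZP.<⇒≤ ri<c))
    L = proj₁ offset
    c≡ : c ≡ r l ⊕ L
    c≡ = proj₂ offset
    inQ : ∀ j → inLoad r i (r l) c j ≡ true → Scheduled r d p S j × r l ≤ r j
    inQ j q with inLoad⇒ r i (r l) c j q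
    ... | j≤i , rl≤rj , rj<c = Function.Equivalence.from (scheduled⇔ j)
            (NP.≤-trans j≤i i≤k , ZP.≤-trans rs≤rl rl≤rj ,
             ZP.≤-<-trans (i<j⇒i≤j-1 rj<c) (running⇒<Cmax isCmax Sc-1≡i)) , rl≤rj
    before : ∀ t j → inLoad r i (r l) c j ≡ true → S t ≡ just j → t ℤ.< r l ⊕ L
    before t j q Stj with j FP.≟ i | inLoad⇒ r i (r l) c j q
    ... | yes refl | _ = subst (t ℤ.<_) c≡ (running⇒<completion (Sc-1≡i , idleAfter) Stj)
    ... | no j≢i | j≤i , _ , rj<c = subst (t ℤ.<_) c≡
      (edf-finishes-before edf (Sc-1≡i , idleAfter) (proj₁ (inQ j q)) (d-mono j i (FP.≤∧≢⇒< j≤i j≢i)) rj<c Stj)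
    load≤L : load r p i (r l) c ℕ.≤ L
    load≤L = subst (ℕ._≤ L) (sym (load≡∑ r p i (r l) c))
      (scheduled-∑-≤ r d p S _ (r l) L (λ t j Stj → proj₁ (proj₁ valid t j Stj)) inQ before)

-- The greedy schedule

nothing⊎just : ∀ {A : Set} (x : Maybe A) → x ≡ nothing ⊎ ∃ λ y → x ≡ just y
nothing⊎just nothing  = inj₁ refl
nothing⊎just (just y) = inj₂ (y , refl)

firstTrue-just : ∀ {n} (f : Fin n → Bool) {j} → firstTrue f ≡ just j → f j ≡ true × (∀ j' → j' < j → f j' ≡ false)
firstTrue-just {ℕ.suc n} f eq with f F.zero in f0
firstTrue-just {ℕ.suc n} f refl | true = f0 , λ _ ()
... | false with firstTrue (f ∘ F.suc) in eq′
firstTrue-just {ℕ.suc n} f refl | false | just y with firstTrue-just (f ∘ F.suc) eq′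
... | fy , below = fy , λ { F.zero _ → f0 ; (F.suc j') (ℕ.s≤s j'<y) → below j' j'<y }

firstTrue-nothing : ∀ {n} (f : Fin n → Bool) → firstTrue f ≡ nothing → ∀ j → f j ≡ false
firstTrue-nothing {ℕ.suc n} f eq j with f F.zero in f0
... | false with firstTrue (f ∘ F.suc) in eq′
firstTrue-nothing {ℕ.suc n} f eq F.zero     | false | nothing = f0
firstTrue-nothing {ℕ.suc n} f eq (F.suc j) | false | nothing = firstTrue-nothing (f ∘ F.suc) eq′ j

firstTrue-≤ : ∀ {n} (f : Fin n → Bool) {j} → f j ≡ true → ∃ λ x → firstTrue f ≡ just x × x F.≤ j
firstTrue-≤ f {j} fj with firstTrue f in eq
... | nothing = contradiction (trans (sym fj) (firstTrue-nothing f eq j)) λ ()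
... | just x with FP.<-cmp j x
...   | tri< j<x _ _ = contradiction (trans (sym fj) (proj₂ (firstTrue-just f eq) j j<x)) λ ()
...   | tri≈ _ refl _ = x , refl , FP.≤-refl
...   | tri> _ _ x<j = x , refl , NP.<⇒≤ x<j

∃-step-to-zero : ∀ (f : ℕ → ℕ) N → 0 ℕ.< f 0 → f N ≡ 0 → ∃ λ m → 0 ℕ.< f m × f (ℕ.suc m) ≡ 0 × m ℕ.< N
∃-step-to-zero f ℕ.zero    f0>0 fN≡0 = contradiction (sym fN≡0) (NP.<⇒≢ f0>0)
∃-step-to-zero f (ℕ.suc N) f0>0 fN≡0 with f N in eq
... | ℕ.suc _ = N , subst (0 ℕ.<_) (sym eq) (ℕ.s≤s ℕ.z≤n) , fN≡0 , NP.≤-refl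
... | ℕ.zero with ∃-step-to-zero f N f0>0 eq
...   | m , fm>0 , fm+1≡0 , m<N = m , fm>0 , fm+1≡0 , NP.m≤n⇒m≤1+n m<N

module GreedyFacts {n : ℕ} (r : Fin n → ℤ) (p : Fin n → ℕ) (s k : Fin n) where
  open Greedy r p s k public

  Pending : ℕ → Fin n → Set
  Pending m j = r j ≤ r s ⊕ m × 0 ℕ.< rem m j

  private
    pending : ℕ → Fin n → Bool
    pending m j = (r j ℤ.≤ᵇ r s ⊕ m) ∧ not (rem m j ℕ.≡ᵇ 0)

    Pending⇒pending : ∀ {m j} → Pending m j → pending m j ≡ true
    Pending⇒pending {m} {j} (released , rem>0) with rem m j
    ... | ℕ.suc _ = cong (_∧ true) (≤⇒≤ᵇ released)

  choice⇒Pending : ∀ {m j} → choice m ≡ just j → Pending m j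
  choice⇒Pending {m} {j} eq with r j ℤ.≤ᵇ r s ⊕ m in released | rem m j | proj₁ (firstTrue-just (pending m) eq)
  ... | true | ℕ.suc _ | _ = ≤ᵇ⇒≤ released , ℕ.s≤s ℕ.z≤n

  Pending⇒choice : ∀ {m j} → Pending m j → ∃ λ x → choice m ≡ just x × x F.≤ j
  Pending⇒choice pend = firstTrue-≤ (pending _) (Pending⇒pending pend)

  choice-≤ : ∀ {m x j} → choice m ≡ just x → Pending m j → x F.≤ j
  choice-≤ eq pend with Pending⇒choice pend
  ... | x′ , eq′ , x′≤j = subst (F._≤ _) (just-injective (trans (sym eq′) eq)) x′≤j

  rem-suc : ∀ m j → rem m j ≡ [ isJob (choice m) j ] ℕ.+ rem (ℕ.suc m) j
  rem-suc m j with isJob (choice m) j in runs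
  ... | false = refl
  ... | true with rem m j | proj₂ (choice⇒Pending (isJob⇒≡just (choice m) j runs))
  ...   | ℕ.suc _ | _ = refl

  rem-choice : ∀ {m j} → choice m ≡ just j → rem m j ≡ ℕ.suc (rem (ℕ.suc m) j)
  rem-choice {m} {j} eq = begin
    rem m j                                        ≡⟨ rem-suc m j ⟩
    [ isJob (choice m) j ] ℕ.+ rem (ℕ.suc m) j     ≡⟨ cong (λ c → [ isJob c j ] ℕ.+ rem (ℕ.suc m) j) eq ⟩
    [ isJob (just j) j ] ℕ.+ rem (ℕ.suc m) j       ≡⟨ cong (λ b → [ b ] ℕ.+ rem (ℕ.suc m) j) (isJob-refl j) ⟩
    ℕ.suc (rem (ℕ.suc m) j)                        ∎
    where open ≡-Reasoning

  rem-¬choice : ∀ {m j} → choice m ≢ just j → rem (ℕ.suc m) j ≡ rem m j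
  rem-¬choice {m} {j} ne = sym (trans (rem-suc m j) (cong (λ b → [ b ] ℕ.+ rem (ℕ.suc m) j) (≢just⇒¬isJob (choice m) j ne)))

  rem-suc-≤ : ∀ m j → rem (ℕ.suc m) j ℕ.≤ rem m j
  rem-suc-≤ m j = subst (rem (ℕ.suc m) j ℕ.≤_) (sym (rem-suc m j)) (NP.m≤n+m _ _)

  rem-antitone : ∀ {m m'} j → m ℕ.≤ m' → rem m' j ℕ.≤ rem m j
  rem-antitone {m' = ℕ.zero}   j ℕ.z≤n = NP.≤-refl
  rem-antitone {m' = ℕ.suc m'} j m≤m' with NP.m≤n⇒m<n∨m≡n m≤m'
  ... | inj₂ refl = NP.≤-refl
  ... | inj₁ m<m' = NP.≤-trans (rem-suc-≤ m' j) (rem-antitone j (NP.≤-pred m<m'))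

  eligible⇒ : ∀ {j} → eligible j ≡ true → j F.≤ k × r s ≤ r j
  eligible⇒ {j} eq with F.toℕ j ℕ.≤ᵇ F.toℕ k in e₁ | r s ℤ.≤ᵇ r j in e₂
  ... | true | true = ℕ≤ᵇ⇒≤ e₁ , ≤ᵇ⇒≤ e₂

  eligible⇐ : ∀ {j} → j F.≤ k → r s ≤ r j → eligible j ≡ true
  eligible⇐ j≤k rs≤rj = cong₂ _∧_ (ℕ≤⇒≤ᵇ j≤k) (≤⇒≤ᵇ rs≤rj)

  rem-zero : ∀ {j} → eligible j ≡ true → rem 0 j ≡ p j
  rem-zero eq rewrite eq = refl

  rem-ineligible : ∀ {j} → eligible j ≡ false → ∀ m → rem m j ≡ 0
  rem-ineligible eq ℕ.zero    rewrite eq = refl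
  rem-ineligible eq (ℕ.suc m) = NP.n≤0⇒n≡0 (subst (rem (ℕ.suc m) _ ℕ.≤_) (rem-ineligible eq m) (rem-suc-≤ m _))

  rem-positive⇒eligible : ∀ {m j} → 0 ℕ.< rem m j → eligible j ≡ true
  rem-positive⇒eligible {m} {j} rem>0 with eligible j in eq
  ... | true  = refl
  ... | false = contradiction (rem-ineligible eq m) (NP.>⇒≢ rem>0)

  choice⇒eligible : ∀ {m j} → choice m ≡ just j → eligible j ≡ true
  choice⇒eligible {m} chosen = rem-positive⇒eligible {m} (proj₂ (choice⇒Pending {m} chosen))

  rem-unreleased : ∀ m j → r s ⊕ m ≤ r j → rem m j ≡ rem 0 j
  rem-unreleased ℕ.zero    j _          = refl
  rem-unreleased (ℕ.suc m) j unreleased =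
    trans (rem-¬choice (λ eq → ZP.<⇒≱ r⊕m<rj (proj₁ (choice⇒Pending eq))))
          (rem-unreleased m j (ZP.<⇒≤ r⊕m<rj))
    where r⊕m<rj = ZP.<-≤-trans (⊕-monoʳ-< (r s) (NP.n<1+n m)) unreleased

  greedy-⊕ : ∀ m → greedy (r s ⊕ m) ≡ choice m
  greedy-⊕ m = cong greedyAt (lemma (r s) (ℤ.+ m))
    where lemma : ∀ a x → (a ℤ.+ x) ℤ.- a ≡ x
          lemma = ZR.solve-∀

  greedy≡just⇒ : ∀ t {j} → greedy t ≡ just j → ∃ λ m → t ≡ r s ⊕ m × choice m ≡ just j
  greedy≡just⇒ t eq with t ℤ.- r s in offset
  ... | ℤ.+ m = m , trans (sym (lemma t (r s))) (cong (λ x → r s ℤ.+ x) offset) , eq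
    where lemma : ∀ a b → b ℤ.+ (a ℤ.- b) ≡ a
          lemma = ZR.solve-∀

  rem≡countFrom+rem : ∀ j m a → rem a j ≡ countFrom (λ t → isJob (greedy t) j) (r s ⊕ a) m ℕ.+ rem (a ℕ.+ m) j
  rem≡countFrom+rem j ℕ.zero    a = cong (λ x → rem x j) (sym (NP.+-identityʳ a))
  rem≡countFrom+rem j (ℕ.suc m) a = begin
    rem a j
      ≡⟨ rem-suc a j ⟩
    [ isJob (choice a) j ] ℕ.+ rem (ℕ.suc a) j
      ≡⟨ cong ([ isJob (choice a) j ] ℕ.+_) (rem≡countFrom+rem j m (ℕ.suc a)) ⟩
    [ isJob (choice a) j ] ℕ.+ (countFrom f (r s ⊕ ℕ.suc a) m ℕ.+ rem (ℕ.suc a ℕ.+ m) j)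
      ≡⟨ sym (NP.+-assoc [ isJob (choice a) j ] _ _) ⟩
    [ isJob (choice a) j ] ℕ.+ countFrom f (r s ⊕ ℕ.suc a) m ℕ.+ rem (ℕ.suc a ℕ.+ m) j
      ≡⟨ cong₂ (λ c t → [ isJob c j ] ℕ.+ countFrom f t m ℕ.+ rem (ℕ.suc a ℕ.+ m) j)
               (sym (greedy-⊕ a)) (sym (⊕-suc (r s) a)) ⟩
    countFrom f (r s ⊕ a) (ℕ.suc m) ℕ.+ rem (ℕ.suc a ℕ.+ m) j
      ≡⟨ cong (λ x → countFrom f (r s ⊕ a) (ℕ.suc m) ℕ.+ rem x j) (sym (NP.+-suc a m)) ⟩
    countFrom f (r s ⊕ a) (ℕ.suc m) ℕ.+ rem (a ℕ.+ ℕ.suc m) j ∎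
    where
    open ≡-Reasoning
    f : ℤ → Bool
    f t = isJob (greedy t) j

  RunsUpTo : Fin n → ℕ → Set
  RunsUpTo j m = ∃ λ x → choice m ≡ just x × x F.≤ j

  runsUpTo? : ∀ j m → Dec (RunsUpTo j m)
  runsUpTo? j m with choice m
  ... | nothing = no λ { (_ , () , _) }
  ... | just x with x F.≤? j
  ...   | yes x≤j = yes (x , refl , x≤j)
  ...   | no  x≰j = no λ { (_ , refl , x≤j) → x≰j x≤j }

  BusyFrom : Fin n → ℕ → ℕ → Set
  BusyFrom j a m = ∀ t → a ℕ.≤ t → t ℕ.≤ m → RunsUpTo j t

  CannotExtend : Fin n → ℕ → Set
  CannotExtend j a = a ≡ 0 ⊎ ∃ λ a' → a ≡ ℕ.suc a' × ¬ RunsUpTo j a'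

  extendBusy : ∀ j m x → BusyFrom j x m → ∃ λ a → a ℕ.≤ x × BusyFrom j a m × CannotExtend j a
  extendBusy j m ℕ.zero    busy = 0 , ℕ.z≤n , busy , inj₁ refl
  extendBusy j m (ℕ.suc x) busy with runsUpTo? j x
  ... | no ¬runs = ℕ.suc x , NP.≤-refl , busy , inj₂ (x , refl , ¬runs)
  ... | yes runs with extendBusy j m x busy′
    where busy′ : BusyFrom j x m
          busy′ t x≤t t≤m with NP.m≤n⇒m<n∨m≡n x≤t
          ... | inj₁ x<t  = busy t x<t t≤m
          ... | inj₂ refl = runs
  ...   | a , a≤x , busyA , atStart = a , NP.m≤n⇒m≤1+n a≤x , busyA , atStart

  -- The maximal interval of steps ending at m in which the greedy runs only jobs ≤ j.
  record BusyPeriod (j : Fin n) (m : ℕ) : Set where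
    field
      onset   : ℕ
      onset≤m : onset ℕ.≤ m
      busy    : BusyFrom j onset m
      cleared : ∀ {j'} → j' F.≤ j → r j' ℤ.< r s ⊕ onset → rem onset j' ≡ 0
      onset≤r : r s ⊕ onset ≤ r j
      leader  : Fin n
      leader≤ : leader F.≤ j
      r-leader : r leader ≡ r s ⊕ onset

  -- A job ≤ j pending at step a - 1 would have been preferred to whatever ran then.
  clearedAtStart : ∀ {j a} → CannotExtend j a → ∀ {j'} → j' F.≤ j → r j' ℤ.< r s ⊕ a → rem a j' ≡ 0
  clearedAtStart (inj₁ refl) {j'} _ rj'<a with eligible j' in eq
  ... | false = refl
  ... | true  = contradiction rj'<a
                  (ZP.≤⇒≯ (subst (_≤ r j') (sym (⊕-identityʳ (r s))) (proj₂ (eligible⇒ eq))))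
  clearedAtStart (inj₂ (a' , refl , ¬runs)) {j'} j'≤j rj'<a with rem a' j' ℕ.≟ 0
  ... | yes rem≡0 = NP.n≤0⇒n≡0 (subst (rem (ℕ.suc a') j' ℕ.≤_) rem≡0 (rem-suc-≤ a' j'))
  ... | no  rem≢0 with Pending⇒choice (released , NP.n≢0⇒n>0 rem≢0)
    where released : r j' ≤ r s ⊕ a'
          released = subst (r j' ≤_) (⊕-suc-pred (r s) a') (i<j⇒i≤j-1 rj'<a)
  ...   | x , chosen , x≤j' = contradiction (x , chosen , FP.≤-trans x≤j' j'≤j) ¬runs

  pending⇒busy : ∀ {j m} → Pending m j → BusyFrom j m m
  pending⇒busy pend t m≤t t≤m rewrite NP.≤-antisym t≤m m≤t = Pending⇒choice pend

  busyPeriod : ∀ {j m} → Pending m j → BusyPeriod j m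
  busyPeriod {j} {m} pend with extendBusy j m m (pending⇒busy pend)
  ... | a , a≤m , busyA , atStart = record
    { onset = a ; onset≤m = a≤m ; busy = busyA ; cleared = cleared ; onset≤r = onset≤r
    ; leader = l ; leader≤ = l≤j ; r-leader = r-leader }
    where
    cleared : ∀ {j'} → j' F.≤ j → r j' ℤ.< r s ⊕ a → rem a j' ≡ 0
    cleared = clearedAtStart atStart
    onset≤r : r s ⊕ a ≤ r j
    onset≤r with r s ⊕ a ZP.≤? r j
    ... | yes le = le
    ... | no  gt = contradiction (cleared FP.≤-refl (ZP.≰⇒> gt)) (NP.>⇒≢ (NP.<-≤-trans (proj₂ pend) (rem-antitone j a≤m)))
    runsA = busyA a NP.≤-refl a≤m
    l = proj₁ runsA
    l≤j = proj₂ (proj₂ runsA)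
    pendingL = choice⇒Pending (proj₁ (proj₂ runsA))
    r-leader : r l ≡ r s ⊕ a
    r-leader with r s ⊕ a ZP.≤? r l
    ... | yes le = ZP.≤-antisym (proj₁ pendingL) le
    ... | no  gt = contradiction (cleared l≤j (ZP.≰⇒> gt)) (NP.>⇒≢ (proj₂ pendingL))

  remUpTo : Fin n → ℕ → Fin n → ℕ
  remUpTo j m j' = if F.toℕ j' ℕ.≤ᵇ F.toℕ j then rem m j' else 0

  ∑remUpTo-suc : ∀ {j m x} → choice m ≡ just x → x F.≤ j → ∑ (remUpTo j m) ≡ ℕ.suc (∑ (remUpTo j (ℕ.suc m)))
  ∑remUpTo-suc {j} {m} {x} chosen x≤j = begin
    ∑ (remUpTo j m)                                                  ≡⟨ sum-cong-≗ step ⟩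
    ∑ (λ j' → remUpTo j (ℕ.suc m) j' ℕ.+ [ isJob (just x) j' ])      ≡⟨ ∑-distrib-+ (remUpTo j (ℕ.suc m)) _ ⟩
    ∑ (remUpTo j (ℕ.suc m)) ℕ.+ ∑ (λ j' → [ isJob (just x) j' ])     ≡⟨ cong (∑ (remUpTo j (ℕ.suc m)) ℕ.+_) (∑[isJob]≡1 x) ⟩
    ∑ (remUpTo j (ℕ.suc m)) ℕ.+ 1                                    ≡⟨ NP.+-comm _ 1 ⟩
    ℕ.suc (∑ (remUpTo j (ℕ.suc m)))                                  ∎
    where
    open ≡-Reasoning
    step : ∀ j' → remUpTo j m j' ≡ remUpTo j (ℕ.suc m) j' ℕ.+ [ isJob (just x) j' ]
    step j' with j' FP.≟ x
    ... | yes refl rewrite isJob-refl j' | ℕ≤⇒≤ᵇ x≤j = trans (rem-choice chosen) (NP.+-comm 1 _)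
    ... | no  j'≢x rewrite isJob-≢ x j' j'≢x =
      trans (cong (λ z → if F.toℕ j' ℕ.≤ᵇ F.toℕ j then z else 0)
                  (sym (rem-¬choice (λ c → j'≢x (just-injective (trans (sym c) chosen))))))
            (sym (NP.+-identityʳ _))

  busy-work : ∀ {j a m} → BusyFrom j a m → ∀ L → a ℕ.+ L ℕ.≤ ℕ.suc m →
              ∑ (remUpTo j a) ≡ L ℕ.+ ∑ (remUpTo j (a ℕ.+ L))
  busy-work {j} {a} busy ℕ.zero    _ = cong (∑ ∘ remUpTo j) (sym (NP.+-identityʳ a))
  busy-work {j} {a} {m} busy (ℕ.suc L) a+L<m+1 = begin
    ∑ (remUpTo j a)                                    ≡⟨ ∑remUpTo-suc chosen x≤j ⟩
    ℕ.suc (∑ (remUpTo j (ℕ.suc a)))                    ≡⟨ cong ℕ.suc (busy-work busy′ L (subst (ℕ._≤ ℕ.suc m) (NP.+-suc a L) a+L<m+1)) ⟩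
    ℕ.suc (L ℕ.+ ∑ (remUpTo j (ℕ.suc a ℕ.+ L)))         ≡⟨ cong (λ x → ℕ.suc (L ℕ.+ ∑ (remUpTo j x))) (sym (NP.+-suc a L)) ⟩
    ℕ.suc L ℕ.+ ∑ (remUpTo j (a ℕ.+ ℕ.suc L))           ∎
    where
    open ≡-Reasoning
    runs = busy a NP.≤-refl (NP.m+n≤o⇒m≤o a (NP.≤-pred (subst (ℕ._≤ ℕ.suc m) (NP.+-suc a L) a+L<m+1)))
    chosen = proj₁ (proj₂ runs)
    x≤j = proj₂ (proj₂ runs)
    busy′ : BusyFrom j (ℕ.suc a) m
    busy′ t a<t t≤m = busy t (NP.<⇒≤ a<t) t≤m

  module _ {j m} (b : BusyPeriod j m) (j≤k : j F.≤ k) (L : ℕ) where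
    open BusyPeriod b

    private
      A = r s ⊕ onset
      B = r s ⊕ (onset ℕ.+ L)

      window : Fin n → ℕ
      window j' = if inLoad r j A B j' then rem (onset ℕ.+ L) j' else 0

      remUpTo+window : ∀ j' → remUpTo j onset j' ℕ.+ window j' ≡
                              (if inLoad r j A B j' then p j' else 0) ℕ.+ remUpTo j (onset ℕ.+ L) j'
      remUpTo+window j' with F.toℕ j' ℕ.≤ᵇ F.toℕ j in j'≤j | A ℤ.≤ᵇ r j' in A≤rj' | B ℤ.≤ᵇ r j' in B≤rj'
      ... | false | _     | _     = refl
      ... | true  | false | _     = trans (NP.+-identityʳ _) (trans done (sym (NP.n≤0⇒n≡0
                                      (subst (rem (onset ℕ.+ L) j' ℕ.≤_) done (rem-antitone j' (NP.m≤m+n onset L))))))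
        where done = cleared (ℕ≤ᵇ⇒≤ j'≤j) (≰ᵇ⇒> A≤rj')
      ... | true  | true  | true  = trans (NP.+-identityʳ _)
                                      (trans (rem-unreleased onset j' (≤ᵇ⇒≤ A≤rj'))
                                             (sym (rem-unreleased (onset ℕ.+ L) j' (≤ᵇ⇒≤ B≤rj'))))
      ... | true  | true  | false = cong (ℕ._+ rem (onset ℕ.+ L) j')
        (trans (rem-unreleased onset j' (≤ᵇ⇒≤ A≤rj'))
               (rem-zero (eligible⇐ (NP.≤-trans (ℕ≤ᵇ⇒≤ j'≤j) j≤k) (ZP.≤-trans (i≤i⊕m (r s) onset) (≤ᵇ⇒≤ A≤rj')))))

    -- Jobs ≤ j released before the onset are finished there, so the L units done in the busy period
    -- all come from the load of [A, B).
    load≡+window : onset ℕ.+ L ℕ.≤ ℕ.suc m → load r p j A B ≡ L ℕ.+ ∑ window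
    load≡+window a+L≤m+1 = sym (NP.+-cancelʳ-≡ _ _ _ (begin
      L ℕ.+ ∑ window ℕ.+ ∑ (remUpTo j (onset ℕ.+ L))
        ≡⟨ lemma L (∑ window) _ ⟩
      L ℕ.+ ∑ (remUpTo j (onset ℕ.+ L)) ℕ.+ ∑ window
        ≡⟨ cong (ℕ._+ ∑ window) (busy-work busy L a+L≤m+1) ⟨
      ∑ (remUpTo j onset) ℕ.+ ∑ window
        ≡⟨ ∑-distrib-+ (remUpTo j onset) window ⟨
      ∑ (λ j' → remUpTo j onset j' ℕ.+ window j')
        ≡⟨ sum-cong-≗ remUpTo+window ⟩
      ∑ (λ j' → (if inLoad r j A B j' then p j' else 0) ℕ.+ remUpTo j (onset ℕ.+ L) j')
        ≡⟨ ∑-distrib-+ _ (remUpTo j (onset ℕ.+ L)) ⟩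
      ∑ (λ j' → if inLoad r j A B j' then p j' else 0) ℕ.+ ∑ (remUpTo j (onset ℕ.+ L))
        ≡⟨ cong (ℕ._+ ∑ (remUpTo j (onset ℕ.+ L))) (load≡∑ r p j A B) ⟨
      load r p j A B ℕ.+ ∑ (remUpTo j (onset ℕ.+ L)) ∎))
      where
      open ≡-Reasoning
      lemma : ∀ x y z → x ℕ.+ y ℕ.+ z ≡ x ℕ.+ z ℕ.+ y
      lemma = NR.solve-∀

    unfinished⇒load> : onset ℕ.+ L ℕ.≤ ℕ.suc m → r j ℤ.< B → 0 ℕ.< rem (onset ℕ.+ L) j → L ℕ.< load r p j A B
    unfinished⇒load> a+L≤m+1 rj<B rem>0 = begin-strict
      L                                 <⟨ NP.m<m+n L rem>0 ⟩
      L ℕ.+ rem (onset ℕ.+ L) j         ≡⟨ cong (L ℕ.+_) inWindow ⟨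
      L ℕ.+ window j                    ≤⟨ NP.+-monoʳ-≤ L (f≤∑f window j) ⟩
      L ℕ.+ ∑ window                    ≡⟨ load≡+window a+L≤m+1 ⟨
      load r p j A B                    ∎
      where
      open NP.≤-Reasoning
      inWindow : window j ≡ rem (onset ℕ.+ L) j
      inWindow rewrite inLoad⇐ r j A B j FP.≤-refl onset≤r rj<B = refl

  leader-inRange : ∀ {i m} (b : BusyPeriod i m) → InRange r p s i (BusyPeriod.leader b)
  leader-inRange b = leader≤ , subst (r s ≤_) (sym r-leader) (i≤i⊕m (r s) onset) , subst (_≤ r _) (sym r-leader) onset≤r
    where open BusyPeriod b

  busy-overload : ∀ {j m} (b : BusyPeriod j m) → j F.≤ k → 0 ℕ.< rem m j →
    ∀ {m'} → BusyPeriod.onset b ℕ.≤ m' → m' ℕ.≤ m → r j ℤ.< r s ⊕ m' →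
    r s ⊕ m' ℤ.< r (BusyPeriod.leader b) ⊕ load r p j (r (BusyPeriod.leader b)) (r s ⊕ m')
  busy-overload {j} {m} b j≤k rem>0 {m'} a≤m' m'≤m rj<m' = begin-strict
    r s ⊕ m'                                            ≡⟨ m'≡ ⟩
    r leader ⊕ L                                        <⟨ ⊕-monoʳ-< (r leader) L<load ⟩
    r leader ⊕ load r p j (r leader) (r s ⊕ m')          ∎
    where
    open BusyPeriod b
    open ZP.≤-Reasoning
    L = m' ℕ.∸ onset
    a+L≡m' : onset ℕ.+ L ≡ m'
    a+L≡m' = NP.m+[n∸m]≡n a≤m'
    B≡ : r s ⊕ (onset ℕ.+ L) ≡ r s ⊕ m'
    B≡ = cong (r s ⊕_) a+L≡m'
    m'≡ : r s ⊕ m' ≡ r leader ⊕ L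
    m'≡ = trans (sym B≡) (trans (sym (⊕-assoc (r s) onset L)) (cong (_⊕ L) (sym r-leader)))
    L<load : L ℕ.< load r p j (r leader) (r s ⊕ m')
    L<load = subst₂ (λ A B → L ℕ.< load r p j A B) (sym r-leader) B≡
      (unfinished⇒load> b j≤k L (subst (ℕ._≤ ℕ.suc m) (sym a+L≡m') (NP.m≤n⇒m≤1+n m'≤m))
        (subst (r j ℤ.<_) (sym B≡) rj<m')
        (NP.<-≤-trans rem>0 (rem-antitone j (subst (ℕ._≤ m) (sym a+L≡m') m'≤m))))

  busy-completion-≤-Bset : ∀ {j m} (b : BusyPeriod j m) → j F.≤ k → 0 ℕ.< rem m j →
                           ∀ b' → Bset r p j (BusyPeriod.leader b) b' → r s ⊕ ℕ.suc m ≤ b'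
  busy-completion-≤-Bset {j} {m} b j≤k rem>0 b' (rj<b' , bounded) with r s ⊕ ℕ.suc m ZP.≤? b'
  ... | yes le = le
  ... | no  gt = contradiction bounded (ZP.<⇒≱ (subst (λ x → x ℤ.< r leader ⊕ load r p j (r leader) x) (sym b'≡)
                   (busy-overload b j≤k rem>0 a≤m' m'≤m (subst (r j ℤ.<_) b'≡ rj<b'))))
    where
    open BusyPeriod b
    offset = i≤j⇒∃[o]j≡i⊕o (ZP.≤-trans (ZP.≤-trans (i≤i⊕m (r s) onset) onset≤r) (ZP.<⇒≤ rj<b'))
    m' = proj₁ offset
    b'≡ : b' ≡ r s ⊕ m'
    b'≡ = proj₂ offset
    m'≤m : m' ℕ.≤ m
    m'≤m = NP.≤-pred (⊕-cancelˡ-< (r s) (subst (ℤ._< _) b'≡ (ZP.≰⇒> gt)))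
    a≤m' : onset ℕ.≤ m'
    a≤m' = ⊕-cancelˡ-≤ (r s) (subst (r s ⊕ onset ≤_) b'≡ (ZP.≤-trans onset≤r (ZP.<⇒≤ rj<b')))

  greedy-completion : ∀ {m j} → choice m ≡ just j → rem (ℕ.suc m) j ≡ 0 → IsCompletion greedy j (r s ⊕ ℕ.suc m)
  greedy-completion {m} {j} chosen done = trans (cong greedy (⊕-suc-pred (r s) m)) (trans (greedy-⊕ m) chosen) , idle
    where
    idle : ∀ t → r s ⊕ ℕ.suc m ≤ t → greedy t ≢ just j
    idle t after runs with greedy≡just⇒ t runs
    ... | m' , refl , chosen′ = NP.>⇒≢ (proj₂ (choice⇒Pending {m'} chosen′))
      (NP.n≤0⇒n≡0 (subst (rem m' j ℕ.≤_) done (rem-antitone j (⊕-cancelˡ-≤ (r s) after))))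

-- Feasible instances

module Feasibility {n : ℕ} (r d : Fin n → ℤ) (p : Fin n → ℕ) (p>0 : ∀ j → 0 ℕ.< p j)
                   (d-mono : ∀ j j' → j < j' → d j ℤ.< d j') (feasible : Feasible r d p) where

  d-mono-≤ : ∀ {j j'} → j' F.≤ j → d j' ≤ d j
  d-mono-≤ {j} {j'} j'≤j with j' FP.≟ j
  ... | yes refl = ZP.≤-refl
  ... | no  j'≢j = ZP.<⇒≤ (d-mono j' j (FP.≤∧≢⇒< j'≤j j'≢j))

  private
    S = proj₁ feasible
    valid = proj₁ (proj₂ feasible)
    all-scheduled = proj₂ (proj₂ (proj₂ feasible))

  r<d : ∀ j → r j ℤ.< d j
  r<d j with r j ZP.<? d j
  ... | yes rj<dj = rj<dj
  ... | no  rj≮dj = contradiction (trans (sym (all-scheduled j)) noSlots) (NP.>⇒≢ (p>0 j))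
    where
    noSlots : slots r d p S j ≡ 0
    noSlots = cong (λ x → countFrom (λ t → isJob (S t) j) (r j) ℤ.∣ x ∣)
                   (ZP.i≤j⇒i⊔j≡j (ZP.i≤j⇒i-j≤0 (ZP.≮⇒≥ rj≮dj)))

  ⊕load≤d : ∀ j a → a ≤ d j → a ⊕ load r p j a (d j) ≤ d j
  ⊕load≤d j a a≤dj with i≤j⇒∃[o]j≡i⊕o a≤dj
  ... | L , dj≡ = subst (a ⊕ load r p j a (d j) ≤_) (sym dj≡) (⊕-monoʳ-≤ a
    (subst (ℕ._≤ L) (sym (load≡∑ r p j a (d j)))
    (scheduled-∑-≤ r d p S (inLoad r j a (d j)) a L (λ t j' Stj' → proj₁ (proj₁ valid t j' Stj'))
      (λ j' q → all-scheduled j' , proj₁ (proj₂ (inLoad⇒ r j a (d j) j' q)))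
      (λ t j' q Stj' → subst (t ℤ.<_) dj≡
        (ZP.<-≤-trans (proj₂ (proj₁ valid t j' Stj')) (d-mono-≤ (proj₁ (inLoad⇒ r j a (d j) j' q))))))))

module GreedySchedule {n : ℕ} (r d : Fin n → ℤ) (p : Fin n → ℕ) (p>0 : ∀ j → 0 ℕ.< p j)
                      (d-mono : ∀ j j' → j < j' → d j ℤ.< d j') (feasible : Feasible r d p) (s k : Fin n) where
  open Feasibility r d p p>0 d-mono feasible public
  open GreedyFacts r p s k public

  -- A pending eligible job at its deadline would start a busy period overloading the window
  -- up to that deadline, which no schedule of the instance can process.
  greedy-meets-deadline : ∀ {j} → eligible j ≡ true → ∀ D → r s ⊕ D ≡ d j → rem D j ≡ 0
  greedy-meets-deadline {j} elig D D≡dj with rem D j ℕ.≟ 0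
  ... | yes done  = done
  ... | no  rem≢0 = contradiction (⊕load≤d j (r leader) rl≤dj)
    (ZP.<⇒≱ (subst (λ x → x ℤ.< r leader ⊕ load r p j (r leader) x) D≡dj
      (busy-overload b (proj₁ (eligible⇒ elig)) rem>0 onset≤m NP.≤-refl (subst (r j ℤ.<_) (sym D≡dj) (r<d j)))))
    where
    rem>0 = NP.n≢0⇒n>0 rem≢0
    b = busyPeriod (subst (r j ≤_) (sym D≡dj) (ZP.<⇒≤ (r<d j)) , rem>0)
    open BusyPeriod b
    rl≤dj : r leader ≤ d j
    rl≤dj = ZP.≤-trans (ZP.≤-reflexive r-leader) (ZP.≤-trans onset≤r (ZP.<⇒≤ (r<d j)))

  deadlineOffset : ∀ {j} → eligible j ≡ true → ∃ λ D → d j ≡ r s ⊕ D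
  deadlineOffset elig = i≤j⇒∃[o]j≡i⊕o (ZP.≤-trans (proj₂ (eligible⇒ elig)) (ZP.<⇒≤ (r<d _)))

  finished-after-deadline : ∀ {j} → eligible j ≡ true → ∀ m → d j ≤ r s ⊕ m → rem m j ≡ 0
  finished-after-deadline {j} elig m dj≤ with deadlineOffset elig
  ... | D , dj≡ = NP.n≤0⇒n≡0 (NP.≤-trans (rem-antitone j (⊕-cancelˡ-≤ (r s) (subst (_≤ r s ⊕ m) dj≡ dj≤)))
                                        (NP.≤-reflexive (greedy-meets-deadline elig D (sym dj≡))))

  choice⇒<deadline : ∀ {m j} → choice m ≡ just j → r s ⊕ m ℤ.< d j
  choice⇒<deadline {m} {j} chosen with d j ZP.≤? r s ⊕ m
  ... | no  dj≰ = ZP.≰⇒> dj≰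
  ... | yes dj≤ = contradiction (finished-after-deadline (choice⇒eligible {m} chosen) m dj≤)
                                (NP.>⇒≢ (proj₂ (choice⇒Pending {m} chosen)))

  greedy-slots-eligible : ∀ {j} → eligible j ≡ true → slots r d p greedy j ≡ p j
  greedy-slots-eligible {j} elig with i≤j⇒∃[o]j≡i⊕o (proj₂ (eligible⇒ elig)) | i≤j⇒∃[o]j≡i⊕o (ZP.<⇒≤ (r<d j))
  ... | ρ , rj≡ | L , dj≡ = begin
    countFrom f (r j) ℤ.∣ (d j ℤ.- r j) ℤ.⊔ ℤ.0ℤ ∣       ≡⟨ cong (λ x → countFrom f (r j) ℤ.∣ (x ℤ.- r j) ℤ.⊔ ℤ.0ℤ ∣) dj≡ ⟩
    countFrom f (r j) ℤ.∣ (r j ⊕ L ℤ.- r j) ℤ.⊔ ℤ.0ℤ ∣   ≡⟨ cong (countFrom f (r j)) (window-length (r j) L) ⟩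
    countFrom f (r j) L                                 ≡⟨ cong (λ x → countFrom f x L) rj≡ ⟩
    countFrom f (r s ⊕ ρ) L                             ≡⟨ NP.+-identityʳ _ ⟨
    countFrom f (r s ⊕ ρ) L ℕ.+ 0                       ≡⟨ cong (countFrom f (r s ⊕ ρ) L ℕ.+_) finished ⟨
    countFrom f (r s ⊕ ρ) L ℕ.+ rem (ρ ℕ.+ L) j         ≡⟨ rem≡countFrom+rem j L ρ ⟨
    rem ρ j                                             ≡⟨ rem-unreleased ρ j (ZP.≤-reflexive (sym rj≡)) ⟩
    rem 0 j                                             ≡⟨ rem-zero elig ⟩
    p j                                                 ∎
    where
    open ≡-Reasoning
    f : ℤ → Bool
    f t = isJob (greedy t) j
    window-length : ∀ a L → ℤ.∣ (a ⊕ L ℤ.- a) ℤ.⊔ ℤ.0ℤ ∣ ≡ L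
    window-length a L = cong ℤ.∣_∣ (trans (cong (ℤ._⊔ ℤ.0ℤ) (lemma a (ℤ.+ L))) (ZP.i≥j⇒i⊔j≡i (ℤ.+≤+ ℕ.z≤n)))
      where lemma : ∀ a x → (a ℤ.+ x) ℤ.- a ≡ x
            lemma = ZR.solve-∀
    finished : rem (ρ ℕ.+ L) j ≡ 0
    finished = greedy-meets-deadline elig (ρ ℕ.+ L)
      (trans (sym (⊕-assoc (r s) ρ L)) (trans (cong (_⊕ L) (sym rj≡)) (sym dj≡)))

  greedy-slots-ineligible : ∀ {j} → eligible j ≡ false → slots r d p greedy j ≡ 0
  greedy-slots-ineligible {j} inelig = countFrom-none _ (r j) ℤ.∣ (d j ℤ.- r j) ℤ.⊔ ℤ.0ℤ ∣ (λ t _ _ → neverRuns t)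
    where
    neverRuns : ∀ t → isJob (greedy t) j ≡ false
    neverRuns t = ≢just⇒¬isJob (greedy t) j λ runs →
      let (m , _ , chosen) = greedy≡just⇒ t runs
      in contradiction (trans (sym (choice⇒eligible {m} chosen)) inelig) λ ()

  greedy-scheduled⇒eligible : ∀ {j} → Scheduled r d p greedy j → eligible j ≡ true
  greedy-scheduled⇒eligible {j} sched with eligible j in eq
  ... | true  = refl
  ... | false = contradiction (trans (sym sched) (greedy-slots-ineligible eq)) (NP.>⇒≢ (p>0 j))

  greedy-valid : ValidSchedule r d p greedy
  greedy-valid = window , slots∈
    where
    window : ∀ t j → greedy t ≡ just j → r j ≤ t × t ℤ.< d j
    window t j runs with greedy≡just⇒ t runs
    ... | m , refl , chosen = proj₁ (choice⇒Pending {m} chosen) , choice⇒<deadline chosen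
    slots∈ : ∀ j → slots r d p greedy j ≡ 0 ⊎ slots r d p greedy j ≡ p j
    slots∈ j with eligible j in eq
    ... | true  = inj₂ (greedy-slots-eligible eq)
    ... | false = inj₁ (greedy-slots-ineligible eq)

  greedy-edf : EarliestDeadline r d p greedy
  greedy-edf t j j' runs _ rj'≤t (t' , t≤t' , runs′) with greedy≡just⇒ t runs | greedy≡just⇒ t' runs′
  ... | m , refl , chosen | m' , refl , chosen′ =
    d-mono-≤ (choice-≤ {m} chosen (rj'≤t , NP.<-≤-trans (proj₂ (choice⇒Pending {m'} chosen′))
                                                       (rem-antitone j' (⊕-cancelˡ-≤ (r s) t≤t'))))

  greedy-finishes : ∀ {j} → eligible j ≡ true → ∃ λ m → choice m ≡ just j × rem (ℕ.suc m) j ≡ 0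
  greedy-finishes {j} elig with deadlineOffset elig
  ... | D , dj≡ with ∃-step-to-zero (λ m → rem m j) D (subst (0 ℕ.<_) (sym (rem-zero elig)) (p>0 j))
                                    (greedy-meets-deadline elig D (sym dj≡))
  ...   | m , rem>0 , done , _ with ≡-dec FP._≟_ (choice m) (just j)
  ...     | yes chosen = m , chosen , done
  ...     | no  ¬chosen = contradiction (trans (sym (rem-¬choice ¬chosen)) done) (NP.>⇒≢ rem>0)

  lastStep : ∀ {i} → eligible i ≡ true →
             ∃ λ M → (∃ λ x → choice M ≡ just x) × (∀ m j → ℕ.suc M ℕ.≤ m → rem m j ≡ 0)
  lastStep {i} elig with i≤j⇒∃[o]j≡i⊕o
    (ZP.≤-trans (proj₂ (eligible⇒ elig)) (ZP.≤-trans (ZP.<⇒≤ (r<d i)) (d-mono-≤ (proj₁ (eligible⇒ elig)))))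
  ... | D , dk≡ with ∃-step-to-zero remaining D (NP.<-≤-trans (subst (0 ℕ.<_) (sym (rem-zero elig)) (p>0 i)) (f≤∑f (rem 0) i))
                                    (∑-zero finishedAtDk)
    where
    remaining : ℕ → ℕ
    remaining m = ∑ (rem m)
    finishedAtDk : ∀ j → rem D j ≡ 0
    finishedAtDk j with eligible j in eligJ
    ... | false = rem-ineligible eligJ D
    ... | true  = finished-after-deadline eligJ D (ZP.≤-trans (d-mono-≤ (proj₁ (eligible⇒ eligJ))) (ZP.≤-reflexive dk≡))
  ...   | M , work>0 , noWork , _ = M , running , allDone
    where
    allDone : ∀ m j → ℕ.suc M ℕ.≤ m → rem m j ≡ 0
    allDone m j M<m = NP.n≤0⇒n≡0
      (NP.≤-trans (rem-antitone j M<m) (subst (rem (ℕ.suc M) j ℕ.≤_) noWork (f≤∑f (rem (ℕ.suc M)) j)))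
    running : ∃ λ x → choice M ≡ just x
    running with nothing⊎just (choice M)
    ... | inj₂ chosen = chosen
    ... | inj₁ idle   = contradiction
      (trans (sym (sum-cong-≗ {n} (λ j → rem-¬choice {M} {j} (λ c → contradiction (trans (sym idle) c) λ ())))) noWork)
      (NP.>⇒≢ work>0)

  greedy-SKSchedule : ∀ {i} → eligible i ≡ true → SKSchedule r d p s k greedy
  greedy-SKSchedule elig with lastStep elig
  ... | M , (x , chosen) , allDone = greedy-valid , greedy-edf , r s ⊕ ℕ.suc M , isCmax , C≤dk , scheduled⇔
    where
    idleAfter : ∀ t → r s ⊕ ℕ.suc M ≤ t → greedy t ≡ nothing
    idleAfter t after with nothing⊎just (greedy t)
    ... | inj₁ idle = idle
    ... | inj₂ (j , runs) with greedy≡just⇒ t runs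
    ...   | m , refl , chosen′ =
      contradiction (allDone m j (⊕-cancelˡ-≤ (r s) after)) (NP.>⇒≢ (proj₂ (choice⇒Pending {m} chosen′)))
    isCmax : IsCmax r d p s greedy (r s ⊕ ℕ.suc M)
    isCmax = inj₂ ((λ idle → contradiction (trans (sym chosen) (trans (sym (greedy-⊕ M))
                     (trans (cong greedy (sym (⊕-suc-pred (r s) M))) idle))) λ ()) , idleAfter)
    C≤dk : r s ⊕ ℕ.suc M ≤ d k
    C≤dk = subst (_≤ d k) (sym (⊕-suc-sucℤ (r s) M))
      (ZP.≤-trans (ZP.i<j⇒suc[i]≤j (choice⇒<deadline chosen)) (d-mono-≤ (proj₁ (eligible⇒ (choice⇒eligible {M} chosen)))))
    scheduled⇔ : ∀ j → Scheduled r d p greedy j ⇔ (j F.≤ k × r s ≤ r j × r j ℤ.< r s ⊕ ℕ.suc M)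
    scheduled⇔ j = mk⇔ to (λ (j≤k , rs≤rj , _) → greedy-slots-eligible (eligible⇐ j≤k rs≤rj))
      where
      to : Scheduled r d p greedy j → j F.≤ k × r s ≤ r j × r j ℤ.< r s ⊕ ℕ.suc M
      to sched = proj₁ (eligible⇒ eligJ) , proj₂ (eligible⇒ eligJ) , released
        where
        eligJ = greedy-scheduled⇒eligible sched
        released : r j ℤ.< r s ⊕ ℕ.suc M
        released with r j ZP.<? r s ⊕ ℕ.suc M
        ... | yes rj<C = rj<C
        ... | no  rj≮C = contradiction
          (trans (sym (rem-zero eligJ))
                 (trans (sym (rem-unreleased (ℕ.suc M) j (ZP.≮⇒≥ rj≮C))) (allDone (ℕ.suc M) j NP.≤-refl)))
          (NP.>⇒≢ (p>0 j))

lemma1 : ∀ {n : ℕ} (r d : Fin n → ℤ) (p : Fin n → ℕ) →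
    (∀ j → 0 ℕ.< p j) →
    (∀ j j' → j < j' → d j ℤ.< d j') →
    Injective _≡_ _≡_ r →
    Feasible r d p →
    ∀ (s k i : Fin n) → i Data.Fin.≤ k → r s ≤ r i →
    ∃ λ c → IsCompletion (Greedy.greedy r p s k) i c ×
            IsMinCompletion r d p s k i c ×
            IsMaxMin r p s i c
lemma1 r d p p>0 d-mono _ feasible s k i i≤k rs≤ri =
  c , completion , ((greedy , greedy-SKSchedule elig , greedy-slots-eligible elig , completion) , minimal) ,
      ((BusyPeriod.leader b , leader-inRange b , bset (leader-inRange b) , least) , maximal)
  where
  open GreedySchedule r d p p>0 d-mono feasible s k
  elig = eligible⇐ i≤k rs≤ri
  m = proj₁ (greedy-finishes elig)
  chosen = proj₁ (proj₂ (greedy-finishes elig))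
  c = r s ⊕ ℕ.suc m
  completion = greedy-completion chosen (proj₂ (proj₂ (greedy-finishes elig)))
  b = busyPeriod (choice⇒Pending {m} chosen)
  bset : ∀ {l} → InRange r p s i l → Bset r p i l c
  bset = completion∈Bset r d p d-mono i≤k (greedy-SKSchedule elig) completion
  least : ∀ b' → Bset r p i (BusyPeriod.leader b) b' → c ≤ b'
  least = busy-completion-≤-Bset b i≤k (proj₂ (choice⇒Pending {m} chosen))
  minimal : ∀ S c' → SKSchedule r d p s k S → Scheduled r d p S i → IsCompletion S i c' → c ≤ c'
  minimal S c' sk _ completion′ = least c' (completion∈Bset r d p d-mono i≤k sk completion′ (leader-inRange b))
  maximal : ∀ l b' → InRange r p s i l → IsLeastB r p i l b' → b' ≤ c
  maximal l b' inRange (_ , b'-least) = b'-least c (bset inRange)
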